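{- There exist regular $\neg$-decreasing total orderings of $Sen(L)$, and hence regular $\neg$-decreasing choice functions for $L$ (namely $\min_<$ for such an ordering $<$).
   Context: $L$ is the classical propositional language with atoms $p_0,p_1,\ldots$ and connectives $\neg,\wedge$; $\sim$ is classical equivalence on $Sen(L)$, $[\alpha]=\{\beta:\beta\sim\alpha\}$. A total ordering $<$ of $Sen(L)$ is regular if $\alpha\not\sim\beta$ and $\alpha<\beta$ imply $\alpha'<\beta'$ for all $\alpha'\in[\alpha],\beta'\in[\beta]$; it is $\neg$-decreasing if for all $\alpha\not\sim\beta$: $\alpha<\beta\iff\neg\beta<\neg\alpha$. A choice function for $L$ assigns to each $\{\alpha,\beta\}\subseteq Sen(L)$ an element of $\{\alpha,\beta\}$. The Axiom of Choice is assumed. -}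

module Defs where

open import Data.Nat using (ℕ)
open import Data.Bool using (Bool; not; _∧_)
open import Data.Product using (_×_)
open import Data.Sum using (_⊎_)
open import Relation.Binary.PropositionalEquality using (_≡_)
open import Relation.Nullary using (¬_)

data Sen : Set where
  atom : ℕ → Sen
  ¬'_  : Sen → Sen
  _∧'_ : Sen → Sen → Sen

eval : (ℕ → Bool) → Sen → Bool
eval v (atom n) = v n
eval v (¬' α)   = not (eval v α)
eval v (α ∧' β) = eval v α ∧ eval v β

_∼_ : Sen → Sen → Set
α ∼ β = (v : ℕ → Bool) → eval v α ≡ eval v β

IsTotalOrdering : (Sen → Sen → Set) → Set
IsTotalOrdering _<_ =
  ((α : Sen) → ¬ (α < α)) ×
  ((α β γ : Sen) → α < β → β < γ → α < γ) ×
  ((α β : Sen) → ¬ (α ≡ β) → (α < β) ⊎ (β < α))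

Regular : (Sen → Sen → Set) → Set
Regular _<_ = (α β α' β' : Sen) → ¬ (α ∼ β) → α < β → α' ∼ α → β' ∼ β → α' < β'

NegDecreasing : (Sen → Sen → Set) → Set
NegDecreasing _<_ = (α β : Sen) → ¬ (α ∼ β) →
  ((α < β) → ((¬' β) < (¬' α))) × (((¬' β) < (¬' α)) → (α < β))

{-# OPTIONS --safe #-}
-- Order sentences by their truth tables, read lexicographically (false before true) as
-- Boolean sequences indexed by an enumeration of all valuations, and break ties between
-- equivalent sentences by a syntactic order.  Equivalent sentences have equal tables, which
-- makes the order regular, and negation complements the table, which reverses the
-- lexicographic order.  Totality needs equivalence to be decidable: a sentence only depends
-- on the atoms below some N, and the first 2^N valuations of the enumeration realise every
-- pattern on those atoms, so comparing tables is a finite search.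
module Submission where

open import Defs
open import Data.Bool using (Bool; true; false; not; _∧_)
open import Data.Bool.Properties using (not-involutive; not-injective)
open import Data.Empty using (⊥-elim)
open import Data.List using (List; []; _∷_)
open import Data.List.Properties using (∷-injectiveʳ)
import Data.List.Relation.Binary.Lex.Strict as Lex
open import Data.List.Relation.Binary.Pointwise using (Pointwise-≡⇒≡)
open import Data.Nat using (ℕ; zero; suc; _+_; _*_; _^_; _<_; _≤_; _⊔_; ⌊_/2⌋; z≤n; s≤s)
open import Data.Nat.Properties
  using (<-strictTotalOrder; <-cmp; <-trans; ≤-trans; m≤m⊔n; m≤n⊔m; +-suc; +-identityʳ;
         +-mono-<; +-mono-≤-<; m<1+n⇒m<n∨m≡n; n≡⌊n+n/2⌋; n≡⌈n+n/2⌉)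
open import Data.Product using (Σ; _×_; _,_; proj₁; ∃-syntax)
open import Data.Sum using (_⊎_; inj₁; inj₂)
open import Function using (_∘_)
open import Relation.Binary.Bundles using (StrictTotalOrder)
open import Relation.Binary.Definitions using (tri<; tri≈; tri>)
open import Relation.Binary.PropositionalEquality using (_≡_; _≗_; refl; sym; trans; cong; cong₂)
open import Relation.Nullary using (¬_)

-- Polish notation, continued by the given tail; being prefix-free makes it injective.
encode : Sen → List ℕ → List ℕ
encode (atom n) r = 0 ∷ n ∷ r
encode (¬' α)   r = 1 ∷ encode α r
encode (α ∧' β) r = 2 ∷ encode α (encode β r)

encode-injective : ∀ α β {r s} → encode α r ≡ encode β s → α ≡ β × r ≡ s
encode-injective (atom n) (atom m) refl = refl , refl
encode-injective (¬' α) (¬' β) eq with encode-injective α β (∷-injectiveʳ eq)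
... | refl , r≡s = refl , r≡s
encode-injective (α₁ ∧' α₂) (β₁ ∧' β₂) eq with encode-injective α₁ β₁ (∷-injectiveʳ eq)
... | refl , eq₂ with encode-injective α₂ β₂ eq₂
...   | refl , r≡s = refl , r≡s

module ListLex = StrictTotalOrder (Lex.<-strictTotalOrder <-strictTotalOrder)

_<ˢ_ : Sen → Sen → Set
α <ˢ β = encode α [] ListLex.< encode β []

<ˢ-irrefl : ∀ α → ¬ (α <ˢ α)
<ˢ-irrefl α = ListLex.irrefl ListLex.Eq.refl

<ˢ-trans : ∀ {α β γ} → α <ˢ β → β <ˢ γ → α <ˢ γ
<ˢ-trans = ListLex.trans

<ˢ-connex : ∀ α β → ¬ (α ≡ β) → α <ˢ β ⊎ β <ˢ α
<ˢ-connex α β α≢β with ListLex.compare (encode α []) (encode β [])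
... | tri< α<β _ _ = inj₁ α<β
... | tri≈ _ eq _  = ⊥-elim (α≢β (proj₁ (encode-injective α β (Pointwise-≡⇒≡ eq))))
... | tri> _ _ β<α = inj₂ β<α


AgreeBelow : ∀ {A : Set} → ℕ → (ℕ → A) → (ℕ → A) → Set
AgreeBelow n s t = ∀ {i} → i < n → s i ≡ t i

agreeBelow-suc : ∀ {A : Set} {n} {s t : ℕ → A} → AgreeBelow n s t → s n ≡ t n → AgreeBelow (suc n) s t
agreeBelow-suc agree sn≡tn i<1+n with m<1+n⇒m<n∨m≡n i<1+n
... | inj₁ i<n  = agree i<n
... | inj₂ refl = sn≡tn

infix 4 _<ᴸ_

_<ᴸ_ : (ℕ → Bool) → (ℕ → Bool) → Set
s <ᴸ t = ∃[ k ] AgreeBelow k s t × s k ≡ false × t k ≡ true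

<ᴸ-irrefl : ∀ s → ¬ (s <ᴸ s)
<ᴸ-irrefl s (k , _ , sk≡false , sk≡true) with trans (sym sk≡false) sk≡true
... | ()

<ᴸ-trans : ∀ {s t u} → s <ᴸ t → t <ᴸ u → s <ᴸ u
<ᴸ-trans (k , s≐t , sk , tk) (l , t≐u , tl , ul) with <-cmp k l
... | tri< k<l _ _ = k , (λ i<k → trans (s≐t i<k) (t≐u (<-trans i<k k<l))) , sk , trans (sym (t≐u k<l)) tk
... | tri≈ _ refl _ with trans (sym tl) tk
...   | ()
<ᴸ-trans (k , s≐t , sk , tk) (l , t≐u , tl , ul) | tri> _ _ l<k =
  l , (λ i<l → trans (s≐t (<-trans i<l l<k)) (t≐u i<l)) , trans (s≐t l<k) tl , ul

<ᴸ-resp-≗ : ∀ {s t s′ t′} → s′ ≗ s → t′ ≗ t → s <ᴸ t → s′ <ᴸ t′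
<ᴸ-resp-≗ s′≗s t′≗t (k , s≐t , sk , tk) =
  k , (λ {i} i<k → trans (s′≗s i) (trans (s≐t i<k) (sym (t′≗t i)))) , trans (s′≗s k) sk , trans (t′≗t k) tk

<ᴸ-not : ∀ {s t} → s <ᴸ t → not ∘ t <ᴸ not ∘ s
<ᴸ-not (k , s≐t , sk , tk) = k , (λ i<k → cong not (sym (s≐t i<k))) , cong not tk , cong not sk

not-<ᴸ : ∀ {s t} → not ∘ t <ᴸ not ∘ s → s <ᴸ t
not-<ᴸ {s} {t} ¬t<¬s =
  <ᴸ-resp-≗ (λ i → sym (not-involutive (s i))) (λ i → sym (not-involutive (t i))) (<ᴸ-not ¬t<¬s)

agreeBelow⊎<ᴸ⊎>ᴸ : ∀ n s t → AgreeBelow n s t ⊎ s <ᴸ t ⊎ t <ᴸ s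
agreeBelow⊎<ᴸ⊎>ᴸ zero    s t = inj₁ λ ()
agreeBelow⊎<ᴸ⊎>ᴸ (suc n) s t with agreeBelow⊎<ᴸ⊎>ᴸ n s t
... | inj₂ differ = inj₂ differ
... | inj₁ agree with s n in sn | t n in tn
...   | false | false = inj₁ (agreeBelow-suc agree (trans sn (sym tn)))
...   | true  | true  = inj₁ (agreeBelow-suc agree (trans sn (sym tn)))
...   | false | true  = inj₂ (inj₁ (n , agree , sn , tn))
...   | true  | false = inj₂ (inj₂ (n , sym ∘ agree , tn , sn))


odd : ℕ → Bool
odd zero          = false
odd (suc zero)    = true
odd (suc (suc n)) = odd n

valuation : ℕ → ℕ → Bool
valuation k zero    = odd k
valuation k (suc i) = valuation ⌊ k /2⌋ i

pushBit : Bool → ℕ → ℕ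
pushBit false k = k + k
pushBit true  k = suc (k + k)

odd-pushBit : ∀ b k → odd (pushBit b k) ≡ b
odd-pushBit false zero    = refl
odd-pushBit true  zero    = refl
odd-pushBit false (suc k) rewrite +-suc k k = odd-pushBit false k
odd-pushBit true  (suc k) rewrite +-suc k k = odd-pushBit true k

⌊pushBit/2⌋ : ∀ b k → ⌊ pushBit b k /2⌋ ≡ k
⌊pushBit/2⌋ false k = sym (n≡⌊n+n/2⌋ k)
⌊pushBit/2⌋ true  k = sym (n≡⌈n+n/2⌉ k)

pushBit-< : ∀ b {k m} → k < m → pushBit b k < 2 * m
pushBit-< false {m = m} k<m rewrite +-identityʳ m = +-mono-< k<m k<m
pushBit-< true  {m = m} k<m rewrite +-identityʳ m = +-mono-≤-< k<m k<m

valuation-onto : ∀ N (v : ℕ → Bool) → ∃[ k ] k < 2 ^ N × AgreeBelow N (valuation k) v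
valuation-onto zero    v = 0 , s≤s z≤n , λ ()
valuation-onto (suc N) v with valuation-onto N (v ∘ suc)
... | k , k<2^N , agree = pushBit (v 0) k , pushBit-< (v 0) k<2^N , agree′
  where
  agree′ : AgreeBelow (suc N) (valuation (pushBit (v 0) k)) v
  agree′ {zero}  _           = odd-pushBit (v 0) k
  agree′ {suc i} (s≤s i<N) rewrite ⌊pushBit/2⌋ (v 0) k = agree i<N


atomBound : Sen → ℕ
atomBound (atom n) = suc n
atomBound (¬' α)   = atomBound α
atomBound (α ∧' β) = atomBound α ⊔ atomBound β

eval-local : ∀ α {N v w} → atomBound α ≤ N → AgreeBelow N v w → eval v α ≡ eval w α
eval-local (atom n) n<N   v≐w = v≐w n<N
eval-local (¬' α)   α≤N   v≐w = cong not (eval-local α α≤N v≐w)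
eval-local (α ∧' β) α∧β≤N v≐w =
  cong₂ _∧_ (eval-local α (≤-trans (m≤m⊔n _ _) α∧β≤N) v≐w)
            (eval-local β (≤-trans (m≤n⊔m _ _) α∧β≤N) v≐w)

truthTable : Sen → ℕ → Bool
truthTable α k = eval (valuation k) α

tableLength : Sen → Sen → ℕ
tableLength α β = 2 ^ (atomBound α ⊔ atomBound β)

agreeBelow⇒∼ : ∀ α β → AgreeBelow (tableLength α β) (truthTable α) (truthTable β) → α ∼ β
agreeBelow⇒∼ α β agree v with valuation-onto (atomBound α ⊔ atomBound β) v
... | k , k<len , vₖ≐v =
  trans (sym (eval-local α (m≤m⊔n _ _) vₖ≐v)) (trans (agree k<len) (eval-local β (m≤n⊔m _ _) vₖ≐v))

≗⇒∼ : ∀ α β → truthTable α ≗ truthTable β → α ∼ β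
≗⇒∼ α β α≗β = agreeBelow⇒∼ α β (λ {k} _ → α≗β k)

∼⇒≗ : ∀ α β → α ∼ β → truthTable α ≗ truthTable β
∼⇒≗ α β α∼β = α∼β ∘ valuation


_≺_ : Sen → Sen → Set
α ≺ β = truthTable α <ᴸ truthTable β ⊎ (truthTable α ≗ truthTable β × α <ˢ β)

≺-irrefl : ∀ α → ¬ (α ≺ α)
≺-irrefl α (inj₁ α<α)       = <ᴸ-irrefl _ α<α
≺-irrefl α (inj₂ (_ , α<α)) = <ˢ-irrefl α α<α

≺-trans : ∀ α β γ → α ≺ β → β ≺ γ → α ≺ γ
≺-trans α β γ (inj₁ α<β)       (inj₁ β<γ)       = inj₁ (<ᴸ-trans α<β β<γ)
≺-trans α β γ (inj₁ α<β)       (inj₂ (β≗γ , _)) = inj₁ (<ᴸ-resp-≗ (λ _ → refl) (sym ∘ β≗γ) α<β)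
≺-trans α β γ (inj₂ (α≗β , _)) (inj₁ β<γ)       = inj₁ (<ᴸ-resp-≗ α≗β (λ _ → refl) β<γ)
≺-trans α β γ (inj₂ (α≗β , α<β)) (inj₂ (β≗γ , β<γ)) = inj₂ ((λ k → trans (α≗β k) (β≗γ k)) , <ˢ-trans α<β β<γ)

≺-connex : ∀ α β → ¬ (α ≡ β) → α ≺ β ⊎ β ≺ α
≺-connex α β α≢β with agreeBelow⊎<ᴸ⊎>ᴸ (tableLength α β) (truthTable α) (truthTable β)
... | inj₂ (inj₁ α<β) = inj₁ (inj₁ α<β)
... | inj₂ (inj₂ β<α) = inj₂ (inj₁ β<α)
... | inj₁ agree with ∼⇒≗ α β (agreeBelow⇒∼ α β agree) | <ˢ-connex α β α≢β
...   | α≗β | inj₁ α<β = inj₁ (inj₂ (α≗β , α<β))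
...   | α≗β | inj₂ β<α = inj₂ (inj₂ (sym ∘ α≗β , β<α))

≺-regular : Regular _≺_
≺-regular α β α′ β′ α≁β (inj₁ α<β) α′∼α β′∼β = inj₁ (<ᴸ-resp-≗ (∼⇒≗ α′ α α′∼α) (∼⇒≗ β′ β β′∼β) α<β)
≺-regular α β α′ β′ α≁β (inj₂ (α≗β , _)) _ _ = ⊥-elim (α≁β (≗⇒∼ α β α≗β))

≺-negDecreasing : NegDecreasing _≺_
≺-negDecreasing α β α≁β = decreasing , reflecting
  where
  decreasing : α ≺ β → (¬' β) ≺ (¬' α)
  decreasing (inj₁ α<β)       = inj₁ (<ᴸ-not α<β)
  decreasing (inj₂ (α≗β , _)) = ⊥-elim (α≁β (≗⇒∼ α β α≗β))
  reflecting : (¬' β) ≺ (¬' α) → α ≺ β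
  reflecting (inj₁ ¬β<¬α)       = inj₁ (not-<ᴸ ¬β<¬α)
  reflecting (inj₂ (¬β≗¬α , _)) = ⊥-elim (α≁β (≗⇒∼ α β (sym ∘ not-injective ∘ ¬β≗¬α)))

theorem2p43 : Σ (Sen → Sen → Set) (λ _<_ → IsTotalOrdering _<_ × Regular _<_ × NegDecreasing _<_)
theorem2p43 = _≺_ , (≺-irrefl , ≺-trans , ≺-connex) , ≺-regular , ≺-negDecreasing
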